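{- An oriented graph $G$ is an in-forest if and only if it is a $1$-Burling oriented graph.
   Context: Rooted trees: for a rooted tree $(T,r)$ and $v\neq r$, $p(v)$ is the parent of $v$. A branch is a path $v_1v_2\dots v_k$ of $T$ with $v_i$ the parent of $v_{i+1}$ for all $i$ (it starts at $v_1$); a branch may be empty. A Burling tree is a 4-tuple $(T,r,\ell,c)$ where $T$ is a rooted tree with root $r$; $\ell$ assigns to every non-leaf vertex $v$ one of its children $\ell(v)$, the last-born of $v$; and $c$ is a function on $V(T)$ such that if $v\neq r$ is not a last-born then $c(v)$ is the vertex set of a (possibly empty) branch of $T$ starting at $\ell(p(v))$, while $c(v)=\varnothing$ if $v$ is the root or a last-born. The oriented graph fully derived from the Burling tree has vertex set $V(T)$ and an arc $uv$ iff $v\in c(u)$. An oriented graph is derived from the Burling tree if it is an induced subgraph of the fully derived oriented graph. An oriented graph $G$ is $k$-Burling if it can be derived from a Burling tree $T$ such that every branch of $T$ contains at most $k$ vertices of $G$. An in-tree is an oriented graph obtained from a rooted tree by orienting every edge towards the root ($uv$ is oriented from $u$ to $v$ iff $v$ lies on the tree path from $u$ to the root); an in-forest is an oriented forest whose connected components are in-trees. -}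

module Defs where

open import Data.Nat using (ℕ; _≤_)
open import Data.Fin using (Fin)
open import Data.Maybe using (Maybe; just; nothing)
open import Data.List using (List; []; _∷_; length)
open import Data.List.Membership.Propositional using (_∈_)
open import Data.List.Relation.Unary.All using (All)
open import Data.List.Relation.Unary.Unique.Propositional using (Unique)
open import Data.Product using (Σ; ∃; _×_; _,_)
open import Data.Sum using (_⊎_)
open import Relation.Binary.PropositionalEquality using (_≡_; _≢_)
open import Relation.Nullary using (¬_)
open import Function.Bundles using (_⇔_)
open import Function.Definitions using (Injective)

record OrientedGraph : Set₁ where
  field
    n     : ℕ
    Arc   : Fin n → Fin n → Set
    irrefl : ∀ v → ¬ Arc v v
    asym   : ∀ u v → Arc u v → ¬ Arc v u
open OrientedGraph public

data Reaches {m : ℕ} (par : Fin m → Maybe (Fin m)) : Fin m → Fin m → Set where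
  here  : ∀ {v} → Reaches par v v
  there : ∀ {v u w} → par v ≡ just u → Reaches par u w → Reaches par v w

-- A rooted tree on vertex set Fin m with root r, given by its parent
-- function: exactly r has no parent, and every vertex reaches r by
-- following parents (so the structure is connected and acyclic).
record RootedTree : Set where
  field
    m      : ℕ
    root   : Fin m
    parent : Fin m → Maybe (Fin m)
    root-noParent : parent root ≡ nothing
    nonroot-parent : ∀ v → v ≢ root → ∃ λ u → parent v ≡ just u
    reachRoot : ∀ v → Reaches parent v root

data IsBranch {m : ℕ} (par : Fin m → Maybe (Fin m)) : List (Fin m) → Set where
  nil  : IsBranch par []
  one  : ∀ x → IsBranch par (x ∷ [])
  cons : ∀ {x y bs} → par y ≡ just x → IsBranch par (y ∷ bs) → IsBranch par (x ∷ y ∷ bs)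

data BranchFrom {m : ℕ} (par : Fin m → Maybe (Fin m)) (s : Fin m) : List (Fin m) → Set where
  empty : BranchFrom par s []
  start : ∀ {bs} → IsBranch par (s ∷ bs) → BranchFrom par s (s ∷ bs)

record BurlingTree : Set where
  field
    tree : RootedTree
  open RootedTree tree public
  field
    lastBorn       : Fin m → Maybe (Fin m)
    lastBorn-child : ∀ v c → lastBorn v ≡ just c → parent c ≡ just v
    lastBorn-leaf  : ∀ v → lastBorn v ≡ nothing → ∀ c → parent c ≢ just v
    -- c(v), given as the list of vertices of a branch (top-down)
    cset : Fin m → List (Fin m)
    cset-root : cset root ≡ []
    cset-last : ∀ v u → parent v ≡ just u → lastBorn u ≡ just v → cset v ≡ []
    cset-other : ∀ v u → parent v ≡ just u → ¬ (lastBorn u ≡ just v) →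
                 Σ (Fin m) λ l → lastBorn u ≡ just l × BranchFrom parent l (cset v)

  DArc : Fin m → Fin m → Set
  DArc u v = v ∈ cset u

open BurlingTree public

DerivedVia : (G : OrientedGraph) (T : BurlingTree) → (Fin (n G) → Fin (m T)) → Set
DerivedVia G T f =
  Injective _≡_ _≡_ f × (∀ u v → Arc G u v ⇔ DArc T (f u) (f v))

KBurling : ℕ → OrientedGraph → Set
KBurling k G =
  Σ BurlingTree λ T → Σ (Fin (n G) → Fin (m T)) λ f →
    DerivedVia G T f ×
    (∀ (b : List (Fin (m T))) → IsBranch (parent T) b →
       ∀ (us : List (Fin (n G))) → Unique us → All (λ u → f u ∈ b) us →
       length us ≤ k)

IsRoot : ∀ {m} → (Fin m → Maybe (Fin m)) → Fin m → Set
IsRoot par v = par v ≡ nothing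

InForest : OrientedGraph → Set
InForest G =
  Σ (Fin (n G) → Maybe (Fin (n G))) λ par →
    (∀ v → ∃ λ r → IsRoot par r × Reaches par v r) ×
    (∀ u v → Arc G u v ⇔ (par u ≡ just v))

-- In a Burling tree, c(x) is a branch whose first vertex ℓ(p(x)) is a
-- last-born (so has empty c), while all its other vertices lie strictly
-- deeper than x.  If every branch carries at most one vertex of G, each
-- vertex of G has at most one out-neighbour, and following out-neighbours
-- either increases the depth in T or stops at a sink: G is an in-forest.
-- Conversely, an in-forest whose vertices have depth < N is derived from
-- a spine s₀ … s_N (root s_N, ℓ(s_{i+1}) = s_i) with every vertex v of
-- depth d hung as a leaf below s_{d+1} and c(v) = s_d w, where w is the
-- parent of v, which hangs below s_d; distinct leaves never share a branch.
module Submission where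

open import Defs
open import Data.Nat using (ℕ; zero; suc; _+_; _≤_; _<_; z≤n; s≤s)
open import Data.Nat.Properties
  using (+-suc; +-identityʳ; +-cancelˡ-≡; ≤-trans; ≤-refl; ≤-reflexive; m≤m+n; +-monoʳ-≤; n≤1+n; <-irrefl)
open import Data.Fin using (Fin; zero; suc; toℕ; fromℕ; fromℕ<; inject₁; join; splitAt)
open import Data.Fin.Properties
  using (toℕ-injective; toℕ-fromℕ<; toℕ-inject₁; injective⇒≤; splitAt-join; join-splitAt; any?)
  renaming (_≟_ to _≟ᶠ_)
open import Data.Maybe using (Maybe; just; nothing)
import Data.Maybe as Maybe
open import Data.Maybe.Properties using (just-injective; map-∘) renaming (≡-dec to ≡-dec-Maybe)
open import Data.List using (List; []; _∷_; length)
import Data.List as List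
open import Data.List.Membership.Propositional using (_∈_)
open import Data.List.Membership.Propositional.Properties using (∉[])
open import Data.List.Relation.Unary.Any using (here; there)
open import Data.List.Relation.Unary.All using (All; []; _∷_)
open import Data.List.Relation.Unary.AllPairs using ([]; _∷_)
open import Data.List.Relation.Unary.Unique.Propositional using (Unique)
open import Data.Product using (Σ; ∃; _×_; _,_; proj₁; proj₂)
open import Data.Sum using (_⊎_; inj₁; inj₂)
open import Data.Sum.Properties using (inj₂-injective)
open import Data.Empty using (⊥; ⊥-elim)
open import Relation.Binary.PropositionalEquality
open import Relation.Nullary using (¬_; Dec; yes; no)
open import Function.Base using (_∘′_)
open import Function.Bundles using (_⇔_; mk⇔; Equivalence)

module _ {k : ℕ} {par : Fin k → Maybe (Fin k)} where

  pathLength : ∀ {v r} → Reaches par v r → ℕ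
  pathLength here        = zero
  pathLength (there _ p) = suc (pathLength p)

  pathLength-unique : ∀ {v r r′} → IsRoot par r → IsRoot par r′ →
                      (p : Reaches par v r) (q : Reaches par v r′) →
                      pathLength p ≡ pathLength q
  pathLength-unique _ _  here here = refl
  pathLength-unique ρ _  here (there e _) with () ← trans (sym ρ) e
  pathLength-unique _ ρ′ (there e _) here with () ← trans (sym ρ′) e
  pathLength-unique ρ ρ′ (there e p) (there e′ q)
    with refl ← just-injective (trans (sym e) e′) = cong suc (pathLength-unique ρ ρ′ p q)

  vertexAt : ∀ {v r} (p : Reaches par v r) (i : Fin (suc (pathLength p))) →
             Σ (Fin k) λ x → Σ (Reaches par x r) λ q → pathLength q + toℕ i ≡ pathLength p
  vertexAt {v} p zero = v , p , +-identityʳ (pathLength p)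
  vertexAt (there _ p) (suc i) with vertexAt p i
  ... | x , q , eq = x , q , trans (+-suc (pathLength q) (toℕ i)) (cong suc eq)

  -- The vertices of a path to a root are distinct, as each one determines
  -- its remaining distance to a root.
  pathLength<size : ∀ {v r} → IsRoot par r → (p : Reaches par v r) → pathLength p < k
  pathLength<size ρ p = injective⇒≤ {f = λ i → proj₁ (vertexAt p i)} distinct
    where
    distinct : ∀ {i j} → proj₁ (vertexAt p i) ≡ proj₁ (vertexAt p j) → i ≡ j
    distinct {i} {j} eq with vertexAt p i | vertexAt p j
    ... | x , q , eqᵢ | y , q′ , eqⱼ with refl ← eq =
      toℕ-injective (+-cancelˡ-≡ (pathLength q) (toℕ i) (toℕ j)
        (trans eqᵢ (trans (sym eqⱼ) (cong (_+ toℕ j) (pathLength-unique ρ ρ q′ q)))))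

Reaches-map : ∀ {a b} {par : Fin a → Maybe (Fin a)} {par′ : Fin b → Maybe (Fin b)}
              (g : Fin a → Fin b) → (∀ x → par′ (g x) ≡ Maybe.map g (par x)) →
              ∀ {x y} → Reaches par x y → Reaches par′ (g x) (g y)
Reaches-map g comm here        = here
Reaches-map g comm (there e p) = there (trans (comm _) (cong (Maybe.map g) e)) (Reaches-map g comm p)

ReachesRoot : ∀ {k} → (Fin k → Maybe (Fin k)) → Fin k → Set
ReachesRoot par v = ∃ λ r → IsRoot par r × Reaches par v r

reachesRoot-byMeasure : ∀ {k} (par : Fin k → Maybe (Fin k)) (h : Fin k → ℕ) {B : ℕ} →
                        (∀ v → h v < B) →
                        (∀ {u w} → par u ≡ just w → h u < h w ⊎ IsRoot par w) →
                        ∀ v → ReachesRoot par v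
reachesRoot-byMeasure par h {B} h<B climbs v = go B v (m≤m+n B (h v))
  where
  go : ∀ fuel v → B ≤ fuel + h v → ReachesRoot par v
  go fuel v B≤ with par v in e
  ... | nothing = v , e , here
  ... | just w with climbs e
  ...   | inj₂ ρ = w , ρ , there e here
  go zero    v B≤ | just w | inj₁ _  = ⊥-elim (<-irrefl refl (≤-trans (h<B v) B≤))
  go (suc f) v B≤ | just w | inj₁ lt
    with go f w (≤-trans B≤ (≤-trans (≤-reflexive (sym (+-suc f (h v)))) (+-monoʳ-≤ f lt)))
  ...   | r , ρ , p = r , ρ , there e p

module Depth {k : ℕ} (par : Fin k → Maybe (Fin k)) (toRoot : ∀ v → ReachesRoot par v) where

  depth : Fin k → ℕ
  depth v = pathLength (proj₂ (proj₂ (toRoot v)))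

  depth<size : ∀ v → depth v < k
  depth<size v = pathLength<size (proj₁ (proj₂ (toRoot v))) (proj₂ (proj₂ (toRoot v)))

  depth-parent : ∀ {u w} → par u ≡ just w → depth u ≡ suc (depth w)
  depth-parent {u} {w} e with toRoot u | toRoot w
  ... | _ , ρ , p | _ , ρ′ , q = pathLength-unique ρ ρ′ p (there e q)

IsBranch-leaf-unique : ∀ {k} {par : Fin k → Maybe (Fin k)} {b z z′} → IsBranch par b →
                       z ∈ b → z′ ∈ b → (∀ c → par c ≢ just z) → (∀ c → par c ≢ just z′) → z ≡ z′
IsBranch-leaf-unique (one _)    (here refl) (here refl) _ _ = refl
IsBranch-leaf-unique (cons e _) (here refl) _           leaf _ = ⊥-elim (leaf _ e)
IsBranch-leaf-unique (cons e _) (there _)   (here refl) _ leaf′ = ⊥-elim (leaf′ _ e)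
IsBranch-leaf-unique (cons _ b) (there z∈)  (there z′∈) leaf leaf′ = IsBranch-leaf-unique b z∈ z′∈ leaf leaf′

BranchFrom⇒IsBranch : ∀ {k} {par : Fin k → Maybe (Fin k)} {s bs} → BranchFrom par s bs → IsBranch par bs
BranchFrom⇒IsBranch empty     = nil
BranchFrom⇒IsBranch (start b) = b

module Burling (T : BurlingTree) where

  open Depth (parent T) (λ v → root T , root-noParent T , reachRoot T v) public

  cset-shape : ∀ x → cset T x ≡ [] ⊎
               (∃ λ u → ∃ λ l → parent T x ≡ just u × lastBorn T u ≡ just l × BranchFrom (parent T) l (cset T x))
  cset-shape x with x ≟ᶠ root T
  ... | yes refl = inj₁ (cset-root T)
  ... | no x≢r with nonroot-parent T x x≢r
  ...   | u , e with ≡-dec-Maybe _≟ᶠ_ (lastBorn T u) (just x)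
  ...     | yes lb = inj₁ (cset-last T x u e lb)
  ...     | no ¬lb with cset-other T x u e ¬lb
  ...       | l , lb , b = inj₂ (u , l , e , lb , b)

  cset-isBranch : ∀ x → IsBranch (parent T) (cset T x)
  cset-isBranch x with cset-shape x
  ... | inj₁ eq rewrite eq = nil
  ... | inj₂ (_ , _ , _ , _ , b) = BranchFrom⇒IsBranch b

  IsBranch-depth-≤ : ∀ {z bs y} → IsBranch (parent T) (z ∷ bs) → y ∈ z ∷ bs → depth z ≤ depth y
  IsBranch-depth-≤ b          (here refl) = ≤-refl
  IsBranch-depth-≤ (cons e b) (there y∈)  =
    ≤-trans (≤-trans (n≤1+n _) (≤-reflexive (sym (depth-parent e)))) (IsBranch-depth-≤ b y∈)

  -- The head ℓ(p(x)) of c(x) is a sibling of x, and everything after it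
  -- lies below that sibling.
  cset-deeper-or-empty : ∀ {x y} → y ∈ cset T x → depth x < depth y ⊎ cset T y ≡ []
  cset-deeper-or-empty {x} y∈ with cset-shape x
  ... | inj₁ eq with () ← subst (_ ∈_) eq y∈
  ... | inj₂ (u , l , e , lb , b) = along b y∈
    where
    along : ∀ {bs y} → BranchFrom (parent T) l bs → y ∈ bs → depth x < depth y ⊎ cset T y ≡ []
    along (start _) (here refl) = inj₂ (cset-last T l u (lastBorn-child T u l lb) lb)
    along (start (cons e′ b)) (there y∈) = inj₁ (≤-trans (≤-reflexive sibling+1) (IsBranch-depth-≤ b y∈))
      where
      sibling+1 : suc (depth x) ≡ depth _
      sibling+1 = trans (cong suc (trans (depth-parent e) (sym (depth-parent (lastBorn-child T u l lb)))))
                        (sym (depth-parent e′))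

choice : ∀ {A : Set} {P : A → Set} → Dec (∃ P) → Maybe A
choice (yes (a , _)) = just a
choice (no _)        = nothing

module _ {A : Set} {P : A → Set} where

  choice-sound : ∀ (d : Dec (∃ P)) {a} → choice d ≡ just a → P a
  choice-sound (yes (_ , pa)) refl = pa

  choice-complete : (∀ {a b} → P a → P b → a ≡ b) → ∀ (d : Dec (∃ P)) {a} → P a → choice d ≡ just a
  choice-complete unique (yes (_ , pb)) pa = cong just (unique pb pa)
  choice-complete unique (no ¬∃)        pa = ⊥-elim (¬∃ (_ , pa))

  choice-empty : (∀ a → ¬ P a) → ∀ (d : Dec (∃ P)) → choice d ≡ nothing
  choice-empty ¬P (yes (a , pa)) = ⊥-elim (¬P a pa)
  choice-empty ¬P (no _)         = refl

-- 1-Burling graphs are in-forests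

module OneBurling⇒InForest
  (G : OrientedGraph) (T : BurlingTree) (f : Fin (n G) → Fin (m T))
  (arc⇔ : ∀ u v → Arc G u v ⇔ DArc T (f u) (f v))
  (oneOnBranch : ∀ (b : List (Fin (m T))) → IsBranch (parent T) b →
                 ∀ (us : List (Fin (n G))) → Unique us → All (λ u → f u ∈ b) us → length us ≤ 1)
  where

  open import Data.List.Membership.DecPropositional (_≟ᶠ_ {m T}) using (_∈?_)
  open Burling T

  OutNeighbour : Fin (n G) → Fin (n G) → Set
  OutNeighbour u w = DArc T (f u) (f w)

  outNeighbour-unique : ∀ {u w w′} → OutNeighbour u w → OutNeighbour u w′ → w ≡ w′
  outNeighbour-unique {u} {w} {w′} w∈ w′∈ with w ≟ᶠ w′
  ... | yes eq = eq
  ... | no w≢w′ with oneOnBranch _ (cset-isBranch (f u)) (w ∷ w′ ∷ []) ((w≢w′ ∷ []) ∷ [] ∷ []) (w∈ ∷ w′∈ ∷ [])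
  ...   | s≤s ()

  outNeighbour? : ∀ u → Dec (∃ (OutNeighbour u))
  outNeighbour? u = any? λ w → f w ∈? cset T (f u)

  par : Fin (n G) → Maybe (Fin (n G))
  par u = choice (outNeighbour? u)

  arc⇔par : ∀ u v → Arc G u v ⇔ (par u ≡ just v)
  arc⇔par u v = mk⇔
    (λ a → choice-complete outNeighbour-unique (outNeighbour? u) (Equivalence.to (arc⇔ u v) a))
    (λ e → Equivalence.from (arc⇔ u v) (choice-sound (outNeighbour? u) e))

  par-climbs : ∀ {u w} → par u ≡ just w → depth (f u) < depth (f w) ⊎ IsRoot par w
  par-climbs {u} {w} e with cset-deeper-or-empty (choice-sound (outNeighbour? u) e)
  ... | inj₁ deeper = inj₁ deeper
  ... | inj₂ noArcs = inj₂ (choice-empty (λ w′ w′∈ → ∉[] (subst (f w′ ∈_) noArcs w′∈)) (outNeighbour? w))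

  inForest : InForest G
  inForest = par , reachesRoot-byMeasure par (depth ∘′ f) (λ v → depth<size (f v)) par-climbs , arc⇔par

-- In-forests are 1-Burling

lower₁? : ∀ {k} → Fin (suc k) → Maybe (Fin k)
lower₁? {zero}  zero    = nothing
lower₁? {suc k} zero    = just zero
lower₁? {suc k} (suc i) = Maybe.map suc (lower₁? i)

lower₁?-fromℕ : ∀ k → lower₁? (fromℕ k) ≡ nothing
lower₁?-fromℕ zero    = refl
lower₁?-fromℕ (suc k) rewrite lower₁?-fromℕ k = refl

lower₁?-inject₁ : ∀ {k} (j : Fin k) → lower₁? (inject₁ j) ≡ just j
lower₁?-inject₁ {suc k} zero    = refl
lower₁?-inject₁ {suc k} (suc j) rewrite lower₁?-inject₁ j = refl

lower₁?≡nothing⇒fromℕ : ∀ {k} (i : Fin (suc k)) → lower₁? i ≡ nothing → i ≡ fromℕ k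
lower₁?≡nothing⇒fromℕ {zero}  zero    _ = refl
lower₁?≡nothing⇒fromℕ {suc k} (suc i) e with lower₁? i in eq
... | nothing = cong suc (lower₁?≡nothing⇒fromℕ i eq)

spineParent : ∀ {k} → Fin (suc k) → Maybe (Fin (suc k))
spineParent i = Maybe.map suc (lower₁? i)

spine-reaches-top : ∀ {k} (i : Fin (suc k)) → Reaches spineParent i (fromℕ k)
spine-reaches-top {zero}  zero    = here
spine-reaches-top {suc k} zero    = there refl (Reaches-map suc (λ _ → refl) (spine-reaches-top {k} zero))
spine-reaches-top {suc k} (suc i) = Reaches-map suc (λ _ → refl) (spine-reaches-top i)

module InForest⇒OneBurling
  (G : OrientedGraph) (par : Fin (n G) → Maybe (Fin (n G)))
  (toRoot : ∀ v → ReachesRoot par v) (arc⇔ : ∀ u v → Arc G u v ⇔ (par u ≡ just v))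
  where

  open Depth par toRoot

  N : ℕ
  N = n G

  level : Fin N → Fin N
  level v = fromℕ< (depth<size v)

  level-parent : ∀ {v w} → par v ≡ just w → suc (level w) ≡ inject₁ (level v)
  level-parent {v} {w} e = toℕ-injective (begin
    suc (toℕ (level w))         ≡⟨ cong suc (toℕ-fromℕ< (depth<size w)) ⟩
    suc (depth w)               ≡⟨ sym (depth-parent e) ⟩
    depth v                     ≡⟨ sym (toℕ-fromℕ< (depth<size v)) ⟩
    toℕ (level v)               ≡⟨ sym (toℕ-inject₁ (level v)) ⟩
    toℕ (inject₁ (level v))     ∎)
    where open ≡-Reasoning

  -- inj₁ i is the spine vertex s_i, inj₂ v the leaf carrying v.
  Node : Set
  Node = Fin (suc N) ⊎ Fin N

  parentᴺ : Node → Maybe Node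
  parentᴺ (inj₁ i) = Maybe.map inj₁ (spineParent i)
  parentᴺ (inj₂ v) = just (inj₁ (suc (level v)))

  lastBornᴺ : Node → Maybe Node
  lastBornᴺ (inj₁ zero)    = nothing
  lastBornᴺ (inj₁ (suc j)) = just (inj₁ (inject₁ j))
  lastBornᴺ (inj₂ _)       = nothing

  outBranch : Fin N → Maybe (Fin N) → List Node
  outBranch u nothing  = []
  outBranch u (just w) = inj₁ (inject₁ (level u)) ∷ inj₂ w ∷ []

  csetᴺ : Node → List Node
  csetᴺ (inj₁ _) = []
  csetᴺ (inj₂ u) = outBranch u (par u)

  parentᴺ-shape : ∀ {s s′} → parentᴺ s ≡ just s′ → ∃ λ j → s′ ≡ inj₁ (suc j)
  parentᴺ-shape {inj₁ i} e with lower₁? i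
  parentᴺ-shape {inj₁ i} refl | just j = j , refl
  parentᴺ-shape {inj₂ v} refl = level v , refl

  parentᴺ≡nothing⇒root : ∀ s → parentᴺ s ≡ nothing → s ≡ inj₁ (fromℕ N)
  parentᴺ≡nothing⇒root (inj₁ i) e with lower₁? i in eq
  ... | nothing = cong inj₁ (lower₁?≡nothing⇒fromℕ i eq)

  lastBornᴺ-child : ∀ s {c} → lastBornᴺ s ≡ just c → parentᴺ c ≡ just s
  lastBornᴺ-child (inj₁ (suc j)) refl rewrite lower₁?-inject₁ j = refl

  lastBornᴺ-spine : ∀ s {c} → lastBornᴺ s ≡ just c → csetᴺ c ≡ []
  lastBornᴺ-spine (inj₁ (suc j)) refl = refl

  M : ℕ
  M = suc N + N

  ⌜_⌝ : Node → Fin M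
  ⌜_⌝ = join (suc N) N

  ⌜⌝-injective : ∀ {s t : Node} → ⌜ s ⌝ ≡ ⌜ t ⌝ → s ≡ t
  ⌜⌝-injective {s} {t} e = trans (sym (splitAt-join (suc N) N s))
                                 (trans (cong (splitAt (suc N)) e) (splitAt-join (suc N) N t))

  ∀⌜⌝ : ∀ {P : Fin M → Set} → (∀ s → P ⌜ s ⌝) → ∀ x → P x
  ∀⌜⌝ {P} h x = subst P (join-splitAt (suc N) N x) (h (splitAt (suc N) x))

  parentᵀ : Fin M → Maybe (Fin M)
  parentᵀ x = Maybe.map ⌜_⌝ (parentᴺ (splitAt (suc N) x))

  lastBornᵀ : Fin M → Maybe (Fin M)
  lastBornᵀ x = Maybe.map ⌜_⌝ (lastBornᴺ (splitAt (suc N) x))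

  csetᵀ : Fin M → List (Fin M)
  csetᵀ x = List.map ⌜_⌝ (csetᴺ (splitAt (suc N) x))

  parentᵀ-⌜⌝ : ∀ s → parentᵀ ⌜ s ⌝ ≡ Maybe.map ⌜_⌝ (parentᴺ s)
  parentᵀ-⌜⌝ s = cong (λ t → Maybe.map ⌜_⌝ (parentᴺ t)) (splitAt-join (suc N) N s)

  lastBornᵀ-⌜⌝ : ∀ s → lastBornᵀ ⌜ s ⌝ ≡ Maybe.map ⌜_⌝ (lastBornᴺ s)
  lastBornᵀ-⌜⌝ s = cong (λ t → Maybe.map ⌜_⌝ (lastBornᴺ t)) (splitAt-join (suc N) N s)

  csetᵀ-⌜⌝ : ∀ s → csetᵀ ⌜ s ⌝ ≡ List.map ⌜_⌝ (csetᴺ s)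
  csetᵀ-⌜⌝ s = cong (λ t → List.map ⌜_⌝ (csetᴺ t)) (splitAt-join (suc N) N s)

  map⌜⌝≡just : ∀ (ms : Maybe Node) {x} → Maybe.map ⌜_⌝ ms ≡ just x → ∃ λ s → ms ≡ just s × x ≡ ⌜ s ⌝
  map⌜⌝≡just (just s) refl = s , refl , refl

  parentᵀ≡just : ∀ s {x} → parentᵀ ⌜ s ⌝ ≡ just x → ∃ λ s′ → parentᴺ s ≡ just s′ × x ≡ ⌜ s′ ⌝
  parentᵀ≡just s e = map⌜⌝≡just (parentᴺ s) (trans (sym (parentᵀ-⌜⌝ s)) e)

  lastBornᵀ≡just : ∀ s {x} → lastBornᵀ ⌜ s ⌝ ≡ just x → ∃ λ s′ → lastBornᴺ s ≡ just s′ × x ≡ ⌜ s′ ⌝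
  lastBornᵀ≡just s e = map⌜⌝≡just (lastBornᴺ s) (trans (sym (lastBornᵀ-⌜⌝ s)) e)

  rootᵀ : Fin M
  rootᵀ = ⌜ inj₁ (fromℕ N) ⌝

  rootᵀ-noParent : parentᵀ rootᵀ ≡ nothing
  rootᵀ-noParent rewrite parentᵀ-⌜⌝ (inj₁ (fromℕ N)) | lower₁?-fromℕ N = refl

  nonroot-parentᵀ : ∀ x → x ≢ rootᵀ → ∃ λ u → parentᵀ x ≡ just u
  nonroot-parentᵀ = ∀⌜⌝ λ s s≢r → nonroot s s≢r (parentᴺ s) refl
    where
    nonroot : ∀ s → ⌜ s ⌝ ≢ rootᵀ → ∀ ms → parentᴺ s ≡ ms → ∃ λ u → parentᵀ ⌜ s ⌝ ≡ just u
    nonroot s s≢r nothing  e = ⊥-elim (s≢r (cong ⌜_⌝ (parentᴺ≡nothing⇒root s e)))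
    nonroot s s≢r (just t) e = ⌜ t ⌝ , trans (parentᵀ-⌜⌝ s) (cong (Maybe.map ⌜_⌝) e)

  spine-reaches-rootᵀ : ∀ i → Reaches parentᵀ ⌜ inj₁ i ⌝ rootᵀ
  spine-reaches-rootᵀ i = Reaches-map (λ j → ⌜ inj₁ j ⌝) commutes (spine-reaches-top i)
    where
    commutes : ∀ j → parentᵀ ⌜ inj₁ j ⌝ ≡ Maybe.map (λ j → ⌜ inj₁ j ⌝) (spineParent j)
    commutes j = trans (parentᵀ-⌜⌝ (inj₁ j)) (sym (map-∘ (spineParent j)))

  reachRootᵀ : ∀ x → Reaches parentᵀ x rootᵀ
  reachRootᵀ = ∀⌜⌝ λ where
    (inj₁ i) → spine-reaches-rootᵀ i
    (inj₂ v) → there (parentᵀ-⌜⌝ (inj₂ v)) (spine-reaches-rootᵀ (suc (level v)))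

  lastBornᵀ-child : ∀ v c → lastBornᵀ v ≡ just c → parentᵀ c ≡ just v
  lastBornᵀ-child = ∀⌜⌝ λ s c e → child s (lastBornᵀ≡just s e)
    where
    child : ∀ s {c} → (∃ λ s′ → lastBornᴺ s ≡ just s′ × c ≡ ⌜ s′ ⌝) → parentᵀ c ≡ just ⌜ s ⌝
    child s (s′ , e , refl) = trans (parentᵀ-⌜⌝ s′) (cong (Maybe.map ⌜_⌝) (lastBornᴺ-child s e))

  lastBornᵀ-leaf : ∀ v → lastBornᵀ v ≡ nothing → ∀ c → parentᵀ c ≢ just v
  lastBornᵀ-leaf v noLast = ∀⌜⌝ {P = λ c → parentᵀ c ≢ just v} λ c e → leaf c (parentᵀ≡just c e)
    where
    leaf : ∀ c → (∃ λ s′ → parentᴺ c ≡ just s′ × v ≡ ⌜ s′ ⌝) → ⊥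
    leaf c (s′ , e , refl) with parentᴺ-shape {c} e
    ... | j , refl with () ← trans (sym (lastBornᵀ-⌜⌝ s′)) noLast

  csetᵀ-last : ∀ v u → parentᵀ v ≡ just u → lastBornᵀ u ≡ just v → csetᵀ v ≡ []
  csetᵀ-last v = ∀⌜⌝ λ s _ e → noArcs s (lastBornᵀ≡just s e)
    where
    noArcs : ∀ s → (∃ λ s′ → lastBornᴺ s ≡ just s′ × v ≡ ⌜ s′ ⌝) → csetᵀ v ≡ []
    noArcs s (s′ , e , refl) = trans (csetᵀ-⌜⌝ s′) (cong (List.map ⌜_⌝) (lastBornᴺ-spine s e))

  outBranch-from : ∀ u ms → par u ≡ ms →
                   BranchFrom parentᵀ ⌜ inj₁ (inject₁ (level u)) ⌝ (List.map ⌜_⌝ (outBranch u ms))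
  outBranch-from u nothing  _ = empty
  outBranch-from u (just w) e = start (cons w-below-sₗ (one _))
    where
    w-below-sₗ : parentᵀ ⌜ inj₂ w ⌝ ≡ just ⌜ inj₁ (inject₁ (level u)) ⌝
    w-below-sₗ = trans (parentᵀ-⌜⌝ (inj₂ w)) (cong (λ i → just ⌜ inj₁ i ⌝) (level-parent e))

  csetᵀ-other : ∀ v u → parentᵀ v ≡ just u → ¬ (lastBornᵀ u ≡ just v) →
                Σ (Fin M) λ l → lastBornᵀ u ≡ just l × BranchFrom parentᵀ l (csetᵀ v)
  csetᵀ-other = ∀⌜⌝ λ s u e _ → other s (parentᵀ≡just s e)
    where
    other : ∀ s {u} → (∃ λ s′ → parentᴺ s ≡ just s′ × u ≡ ⌜ s′ ⌝) →
            Σ (Fin M) λ l → lastBornᵀ u ≡ just l × BranchFrom parentᵀ l (csetᵀ ⌜ s ⌝)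
    other (inj₁ i) (s′ , e , refl) with parentᴺ-shape e
    ... | j , refl = _ , lastBornᵀ-⌜⌝ s′ , subst (BranchFrom parentᵀ _) (sym (csetᵀ-⌜⌝ (inj₁ i))) empty
    other (inj₂ w) (_ , refl , refl) =
      _ , lastBornᵀ-⌜⌝ (inj₁ (suc (level w))) ,
      subst (BranchFrom parentᵀ _) (sym (csetᵀ-⌜⌝ (inj₂ w))) (outBranch-from w (par w) refl)

  burlingTree : BurlingTree
  burlingTree = record
    { tree = record { m = M ; root = rootᵀ ; parent = parentᵀ ; root-noParent = rootᵀ-noParent
                    ; nonroot-parent = nonroot-parentᵀ ; reachRoot = reachRootᵀ }
    ; lastBorn = lastBornᵀ ; lastBorn-child = lastBornᵀ-child ; lastBorn-leaf = lastBornᵀ-leaf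
    ; cset = csetᵀ ; cset-root = csetᵀ-⌜⌝ (inj₁ (fromℕ N)) ; cset-last = csetᵀ-last ; cset-other = csetᵀ-other }

  embed : Fin N → Fin M
  embed v = ⌜ inj₂ v ⌝

  embed-injective : ∀ {u v} → embed u ≡ embed v → u ≡ v
  embed-injective e = inj₂-injective (⌜⌝-injective e)

  embed-leaf : ∀ v c → parentᵀ c ≢ just (embed v)
  embed-leaf v = ∀⌜⌝ {P = λ c → parentᵀ c ≢ just (embed v)} λ c e → leaf c (parentᵀ≡just c e)
    where
    leaf : ∀ c → (∃ λ s′ → parentᴺ c ≡ just s′ × embed v ≡ ⌜ s′ ⌝) → ⊥
    leaf c (s′ , e , eq) with parentᴺ-shape {c} e
    ... | j , refl with () ← ⌜⌝-injective {inj₂ v} {inj₁ (suc j)} eq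

  ∈-outBranch : ∀ u v ms → (ms ≡ just v) ⇔ (embed v ∈ List.map ⌜_⌝ (outBranch u ms))
  ∈-outBranch u v nothing  = mk⇔ (λ ()) (λ ())
  ∈-outBranch u v (just w) = mk⇔ (λ { refl → there (here refl) }) from
    where
    from : embed v ∈ List.map ⌜_⌝ (outBranch u (just w)) → just w ≡ just v
    from (here e) with () ← ⌜⌝-injective {inj₂ v} {inj₁ (inject₁ (level u))} e
    from (there (here e)) = cong just (sym (embed-injective e))

  arc⇔DArc : ∀ u v → Arc G u v ⇔ DArc burlingTree (embed u) (embed v)
  arc⇔DArc u v = mk⇔
    (λ a → subst (embed v ∈_) (sym (csetᵀ-⌜⌝ (inj₂ u)))
             (Equivalence.to (∈-outBranch u v (par u)) (Equivalence.to (arc⇔ u v) a)))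
    (λ d → Equivalence.from (arc⇔ u v)
             (Equivalence.from (∈-outBranch u v (par u)) (subst (embed v ∈_) (csetᵀ-⌜⌝ (inj₂ u)) d)))

  oneOnBranch : ∀ (b : List (Fin M)) → IsBranch parentᵀ b →
                ∀ (us : List (Fin N)) → Unique us → All (λ u → embed u ∈ b) us → length us ≤ 1
  oneOnBranch b isB []          _ _ = z≤n
  oneOnBranch b isB (_ ∷ [])    _ _ = s≤s z≤n
  oneOnBranch b isB (x ∷ y ∷ _) ((x≢y ∷ _) ∷ _) (x∈ ∷ y∈ ∷ _) =
    ⊥-elim (x≢y (embed-injective (IsBranch-leaf-unique isB x∈ y∈ (embed-leaf x) (embed-leaf y))))

  oneBurling : KBurling 1 G
  oneBurling = burlingTree , embed , (embed-injective , arc⇔DArc) , oneOnBranch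

lemma4p1 : (G : OrientedGraph) → InForest G ⇔ KBurling 1 G
lemma4p1 G = mk⇔
  (λ (par , toRoot , arc⇔) → InForest⇒OneBurling.oneBurling G par toRoot arc⇔)
  (λ (T , f , (_ , arc⇔) , oneOnBranch) → OneBurling⇒InForest.inForest G T f arc⇔ oneOnBranch)
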